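{- Let $M$ be a matroid on a finite set $E$ with rank function $r$, and let $\ell:E\to\mathbb{N}$ and $W:E\to\mathbb{N}$ be fixed functions. The following are equivalent: (1) for every list assignment $L$ of size $\ell$, $M$ is $W$-colorable from $L$; (2) $M$ is $W$-colorable from the lists $\mathbf{L}(e)=\{1,\dots,\ell(e)\}$; (3) for every $A\subseteq E$, $\sum_{i\in\mathbb{N}_+} r(\{e\in A:\ell(e)\ge i\})\ge \sum_{e\in A}W(e)$.
   Context: A list assignment is a function $L:E\to\mathcal{P}(\mathbb{N})$; it has size $\ell$ if $|L(e)|=\ell(e)$ for every $e\in E$. $M$ is $W$-colorable from lists $L$ if one can choose for each $e\in E$ a set $L'(e)\subseteq L(e)$ of exactly $W(e)$ colors such that, for every color $c$, the set $\{e\in E: c\in L'(e)\}$ is independent in $M$. -}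

module Defs where

open import Data.Nat using (ℕ; zero; suc; _+_; _≤_; _≥_; _⊔_; _≤ᵇ_)
open import Data.Nat.Properties using (_≟_)
open import Data.Fin using (Fin)
open import Data.Fin.Subset using (Subset; _∈_; _⊆_; _∪_; _∩_; ∣_∣; inside; outside; Side)
open import Data.Fin.Subset.Properties using () renaming (_∈?_ to _∈ₛ?_)
open import Data.Vec using (tabulate; lookup)
open import Data.List using (List; length; upTo; allFin; foldr; map; filter)
open import Data.Nat.ListAction using (sum)
open import Data.List.Relation.Unary.Unique.Propositional using (Unique)
import Data.List.Relation.Binary.Subset.Propositional as LS
import Data.List.Membership.Propositional as LM
open import Data.List.Membership.DecPropositional _≟_ using (_∈?_)
open import Data.Product using (Σ; _×_)
open import Relation.Binary.PropositionalEquality using (_≡_)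
open import Relation.Nullary.Decidable using (does)
open import Data.Bool using (Bool; true; false; if_then_else_)

record Matroid (n : ℕ) : Set where
  field
    r          : Subset n → ℕ
    r-bounded  : ∀ A → r A ≤ ∣ A ∣
    r-mono     : ∀ A B → A ⊆ B → r A ≤ r B
    r-submod   : ∀ A B → r (A ∪ B) + r (A ∩ B) ≤ r A + r B

open Matroid public

Independent : ∀ {n} → Matroid n → Subset n → Set
Independent M I = r M I ≡ ∣ I ∣

-- A finite set of colours (a finite subset of ℕ), represented as a
-- duplicate-free list; its size is its length.
-- A list assignment L has size ℓ if each L e is a set of exactly ℓ e colours.
HasSize : ∀ {n} → (Fin n → List ℕ) → (Fin n → ℕ) → Set
HasSize {n} L ℓ = (e : Fin n) → Unique (L e) × length (L e) ≡ ℓ e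

colourClass : ∀ {n} → (Fin n → List ℕ) → ℕ → Subset n
colourClass L' c = tabulate (λ e → if does (c ∈? L' e) then inside else outside)

Colorable : ∀ {n} → Matroid n → (W : Fin n → ℕ) → (L : Fin n → List ℕ) → Set
Colorable {n} M W L =
  Σ (Fin n → List ℕ) λ L' →
      ((e : Fin n) → Unique (L' e) × length (L' e) ≡ W e × (L' e LS.⊆ L e))
    × ((c : ℕ) → Independent M (colourClass L' c))

stdLists : ∀ {n} → (Fin n → ℕ) → Fin n → List ℕ
stdLists ℓ e = map suc (upTo (ℓ e))

atLeast : ∀ {n} → (Fin n → ℕ) → Subset n → ℕ → Subset n
atLeast ℓ A i = tabulate (λ e → if i ≤ᵇ ℓ e then lookup A e else outside)

maxℓ : ∀ {n} → (Fin n → ℕ) → ℕ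
maxℓ {n} ℓ = foldr _⊔_ 0 (map ℓ (allFin n))

-- Σ_{i ∈ ℕ₊} r({e ∈ A : ℓ(e) ≥ i}); all terms with i > max ℓ are r(∅) = 0,
-- so the sum is taken over i = 1, …, max ℓ.
rankSum : ∀ {n} → Matroid n → (Fin n → ℕ) → Subset n → ℕ
rankSum M ℓ A = sum (map (λ i → r M (atLeast ℓ A i)) (map suc (upTo (maxℓ ℓ))))

weightSum : ∀ {n} → (Fin n → ℕ) → Subset n → ℕ
weightSum {n} W A = sum (map (λ e → W e) (filter (λ e → e ∈ₛ? A) (allFin n)))

-- (2) ⇒ (3): colour i lies in 𝐋(e) only when ℓ(e) ≥ i, so the class of colour i meets A in an
-- independent subset of {e ∈ A : ℓ(e) ≥ i}, and summing over i counts each e ∈ A exactly W(e) times.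
--
-- (3) ⇒ (1): colour c may only be given to S_c = {e : c ∈ L(e)}, so a colouring from L is a
-- W-fold covering of E by sets independent in the restrictions M|S_c.  Every e ∈ A lies in ℓ(e) of
-- the sets A ∩ S_c, and a rearrangement argument using submodularity gives
-- Σ_i r{e ∈ A : ℓ(e) ≥ i} ≤ Σ_c r(A ∩ S_c); thus (3) yields W(A) ≤ Σ_c r_c(A) for all A, which is
-- the hypothesis of a covering theorem for a family of matroids (M_c).  That theorem is proved by
-- induction on Σ W: for some e with W(e) > 0 there is a colour c such that no tight set avoiding e
-- spans e in M_c; contracting e in M_c and lowering W(e) by one preserves the hypothesis.

module Submission where

open import Defs

import Algebra.Properties.CommutativeSemigroup as CommutativeSemigroupProperties
import Algebra.Properties.IdempotentCommutativeMonoid as IdempotentCommutativeMonoidProperties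
open import Data.Bool using (Bool; true; false; _∧_; _∨_; if_then_else_)
import Data.Bool.Properties as Bool
open import Data.Fin using (Fin; zero; suc; toℕ; fromℕ<; punchIn)
import Data.Fin.Properties as Fin
open import Data.Fin.Properties using (any?)
open import Data.Fin.Subset using (Subset; _∈_; _∉_; _⊆_; _∪_; _∩_; ∁; ∣_∣; ⊥; ⊤; ⁅_⁆; inside; outside)
open import Data.Fin.Subset.Properties
  using ( ⊆-antisym; p∩q⊆p; x∈p∩q⁺; x∈p∩q⁻; p⊆p∪q; q⊆p∪q; x∈p∪q⁻; x∈⁅y⁆⇒x≡y
        ; ∪-assoc; ∪-identityˡ; ∪-identityʳ; ∩-identityʳ; ∪-inverseʳ; ∩-distribˡ-∪; ∩-distribʳ-∪; ∪-distribʳ-∩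
        ; x∈⁅x⁆; x≢y⇒x∉⁅y⁆; ∪-idempotentCommutativeMonoid; ∩-idempotentCommutativeMonoid
        ; ∣p∩q∣≤∣p∣; ∣⊥∣≡0; ∣⁅x⁆∣≡1; ∉⊥; _∈?_; anySubset? )
open import Data.Nat using (ℕ; zero; suc; _+_; _∸_; _≤_; _<_; _≥_; z≤n; s≤s; z<s; _≤?_; _≤ᵇ_; _⊔_)
open import Data.Nat.Properties
open import Data.Product using (Σ; ∃; ∃₂; _×_; _,_; proj₁; proj₂)
open import Data.Sum using (inj₁; inj₂; [_,_]′)
open import Data.Empty using (⊥-elim)
open import Data.Vec using (_∷_; []; lookup; tabulate; here; there)
open import Data.Vec.Properties
  using (tabulate∘lookup; tabulate-cong; []=⇒lookup; lookup⇒[]=; lookup-zipWith; lookup∘tabulate; lookup-replicate)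
open import Data.Vec.Functional using (removeAt)
open import Data.List using (List; []; _∷_; length; filter; upTo; applyUpTo; allFin)
import Data.List as List
open import Data.List.Properties using (map-∘; map-applyUpTo; map-tabulate; length-map; length-upTo)
open import Data.List.Membership.Propositional.Properties using (∈-map⁺; ∈-map⁻; ∈-upTo⁻; ∈-allFin)
open import Data.List.Relation.Unary.Unique.Propositional.Properties using (map⁺; upTo⁺)
import Data.Nat.ListAction as ListAction
open import Data.List.Membership.Propositional using () renaming (_∈_ to _∈ˡ_)
open import Data.List.Membership.DecPropositional _≟_ using () renaming (_∈?_ to _∈ˡ?_)
import Data.List.Relation.Unary.Any as Any
open import Data.List.Relation.Unary.Unique.Propositional using (Unique)
import Data.List.Relation.Unary.AllPairs as AllPairs
open import Data.List.Relation.Unary.All.Properties using (¬Any⇒All¬; All¬⇒¬Any)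
open import Function using (_∘_)
open import Function.Bundles using (Equivalence; _⇔_; mk⇔)
open import Relation.Binary.PropositionalEquality
open import Relation.Binary.Definitions using (DecidableEquality)
open import Relation.Nullary using (¬_; Dec; contradiction; yes; no; does; ¬?)
open import Relation.Nullary.Decidable using (dec-true; dec-false; _×-dec_; decidable-stable)

open import Algebra.Properties.CommutativeMonoid.Sum +-0-commutativeMonoid
  using (sum; sum-syntax; sum-cong-≗; sum-replicate-zero; sum-remove; ∑-distrib-+; ∑-comm)
open CommutativeSemigroupProperties +-commutativeSemigroup using (xy∙z≈zy∙x; xy∙z≈xz∙y; interchange)

module ∪-Properties {n} = IdempotentCommutativeMonoidProperties (∪-idempotentCommutativeMonoid n)
module ∩-Properties {n} = IdempotentCommutativeMonoidProperties (∩-idempotentCommutativeMonoid n)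

∑-mono-≤ : ∀ {n} {f g : Fin n → ℕ} → (∀ i → f i ≤ g i) → sum f ≤ sum g
∑-mono-≤ {zero}  _   = z≤n
∑-mono-≤ {suc n} f≤g = +-mono-≤ (f≤g zero) (∑-mono-≤ (f≤g ∘ suc))

≤-∑ : ∀ {n} (f : Fin n → ℕ) i → f i ≤ sum f
≤-∑ f zero    = m≤m+n _ _
≤-∑ f (suc i) = m≤n⇒m≤o+n (f zero) (≤-∑ (f ∘ suc) i)

∑-≤1⇒≤n : ∀ {n} (f : Fin n → ℕ) → (∀ i → f i ≤ 1) → sum f ≤ n
∑-≤1⇒≤n {zero}  f f≤1 = z≤n
∑-≤1⇒≤n {suc n} f f≤1 = +-mono-≤ (f≤1 zero) (∑-≤1⇒≤n (f ∘ suc) (f≤1 ∘ suc))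

∑≡suc⇒nonzero : ∀ {n} (f : Fin n → ℕ) {k} → sum f ≡ suc k → ∃₂ λ i w → f i ≡ suc w
∑≡suc⇒nonzero {zero}  f ()
∑≡suc⇒nonzero {suc n} f ∑f≡1+k with f zero in eq
... | suc w = zero , w , eq
... | zero  with i , w , eq′ ← ∑≡suc⇒nonzero (f ∘ suc) ∑f≡1+k = suc i , w , eq′

∑-update : ∀ {n} (f g : Fin n → ℕ) i → (∀ j → j ≢ i → f j ≡ g j) → sum f + g i ≡ sum g + f i
∑-update {suc n} f g i f≗g = begin
  sum f + g i                     ≡⟨ cong (_+ g i) (sum-remove f) ⟩
  f i + sum (removeAt f i) + g i  ≡⟨ cong (λ s → f i + s + g i) (sum-cong-≗ agree) ⟩
  f i + sum (removeAt g i) + g i  ≡⟨ xy∙z≈zy∙x (f i) _ (g i) ⟩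
  g i + sum (removeAt g i) + f i  ≡⟨ cong (_+ f i) (sum-remove g) ⟨
  sum g + f i                     ∎
  where
  open ≡-Reasoning
  agree : ∀ j → f (punchIn i j) ≡ g (punchIn i j)
  agree j = f≗g (punchIn i j) (Fin.punchInᵢ≢i i j)

∑-prefix-≤ : ∀ m k (f : ℕ → ℕ) → ∑[ i < m ] f (toℕ i) ≤ ∑[ i < m + k ] f (toℕ i)
∑-prefix-≤ zero    k f = z≤n
∑-prefix-≤ (suc m) k f = +-monoʳ-≤ (f 0) (∑-prefix-≤ m k (f ∘ suc))

𝟙 : Bool → ℕ
𝟙 true  = 1
𝟙 false = 0

𝟙≤1 : ∀ b → 𝟙 b ≤ 1
𝟙≤1 true  = ≤-refl
𝟙≤1 false = z≤n

lookup-injective : ∀ {n} {p q : Subset n} → (∀ i → lookup p i ≡ lookup q i) → p ≡ q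
lookup-injective {p = p} {q} p≗q =
  trans (sym (tabulate∘lookup p)) (trans (tabulate-cong p≗q) (tabulate∘lookup q))

∈⇒lookup : ∀ {n} {x : Fin n} {p} → x ∈ p → lookup p x ≡ inside
∈⇒lookup = []=⇒lookup

lookup⇒∈ : ∀ {n} {x : Fin n} {p} → lookup p x ≡ inside → x ∈ p
lookup⇒∈ {x = x} {p} = lookup⇒[]= x p

∉⇒lookup : ∀ {n} {x : Fin n} {p} → x ∉ p → lookup p x ≡ outside
∉⇒lookup x∉p = Bool.¬-not (x∉p ∘ lookup⇒∈)

∣p∣≡∑𝟙 : ∀ {n} (p : Subset n) → ∣ p ∣ ≡ ∑[ i < n ] 𝟙 (lookup p i)
∣p∣≡∑𝟙 []            = refl
∣p∣≡∑𝟙 (inside  ∷ p) = cong suc (∣p∣≡∑𝟙 p)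
∣p∣≡∑𝟙 (outside ∷ p) = ∣p∣≡∑𝟙 p

∣p∪⁅x⁆∣≡1+∣p∣ : ∀ {n} {x : Fin n} (p : Subset n) → x ∉ p → ∣ p ∪ ⁅ x ⁆ ∣ ≡ suc ∣ p ∣
∣p∪⁅x⁆∣≡1+∣p∣ {x = zero}  (inside  ∷ p) x∉p = contradiction here x∉p
∣p∪⁅x⁆∣≡1+∣p∣ {x = zero}  (outside ∷ p) x∉p = cong (suc ∘ ∣_∣) (∪-identityʳ p)
∣p∪⁅x⁆∣≡1+∣p∣ {x = suc x} (inside  ∷ p) x∉p = cong suc (∣p∪⁅x⁆∣≡1+∣p∣ p (x∉p ∘ there))
∣p∪⁅x⁆∣≡1+∣p∣ {x = suc x} (outside ∷ p) x∉p = ∣p∪⁅x⁆∣≡1+∣p∣ p (x∉p ∘ there)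

∣p∣≡∣p∩q∣+∣p∩∁q∣ : ∀ {n} (p q : Subset n) → ∣ p ∣ ≡ ∣ p ∩ q ∣ + ∣ p ∩ ∁ q ∣
∣p∣≡∣p∩q∣+∣p∩∁q∣ []            []            = refl
∣p∣≡∣p∩q∣+∣p∩∁q∣ (inside  ∷ p) (inside  ∷ q) = cong suc (∣p∣≡∣p∩q∣+∣p∩∁q∣ p q)
∣p∣≡∣p∩q∣+∣p∩∁q∣ (inside  ∷ p) (outside ∷ q) =
  trans (cong suc (∣p∣≡∣p∩q∣+∣p∩∁q∣ p q)) (sym (+-suc _ _))
∣p∣≡∣p∩q∣+∣p∩∁q∣ (outside ∷ p) (_       ∷ q) = ∣p∣≡∣p∩q∣+∣p∩∁q∣ p q

p∩q∪p∩∁q≡p : ∀ {n} (p q : Subset n) → (p ∩ q) ∪ (p ∩ ∁ q) ≡ p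
p∩q∪p∩∁q≡p p q = begin
  (p ∩ q) ∪ (p ∩ ∁ q)  ≡⟨ ∩-distribˡ-∪ p q (∁ q) ⟨
  p ∩ (q ∪ ∁ q)        ≡⟨ cong (p ∩_) (∪-inverseʳ q) ⟩
  p ∩ ⊤                ≡⟨ ∩-identityʳ p ⟩
  p                    ∎
  where open ≡-Reasoning

∣p∣≤∣p∩q∣⇒p⊆q : ∀ {n} (p q : Subset n) → ∣ p ∣ ≤ ∣ p ∩ q ∣ → p ⊆ q
∣p∣≤∣p∩q∣⇒p⊆q (inside  ∷ p) (inside  ∷ q) _         here        = here
∣p∣≤∣p∩q∣⇒p⊆q (inside  ∷ p) (inside  ∷ q) (s≤s ≤∩) (there x∈p) = there (∣p∣≤∣p∩q∣⇒p⊆q p q ≤∩ x∈p)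
∣p∣≤∣p∩q∣⇒p⊆q (inside  ∷ p) (outside ∷ q) ≤∩       _           =
  contradiction (≤-trans ≤∩ (∣p∩q∣≤∣p∣ p q)) (<-irrefl refl)
∣p∣≤∣p∩q∣⇒p⊆q (outside ∷ p) (_       ∷ q) ≤∩       (there x∈p) = there (∣p∣≤∣p∩q∣⇒p⊆q p q ≤∩ x∈p)

∪-monoˡ-⊆ : ∀ {n} {p q : Subset n} s → p ⊆ q → p ∪ s ⊆ q ∪ s
∪-monoˡ-⊆ {p = p} {q} s p⊆q x∈p∪s with x∈p∪q⁻ p s x∈p∪s
... | inj₁ x∈p = p⊆p∪q s (p⊆q x∈p)
... | inj₂ x∈s = q⊆p∪q q s x∈s

∩-monoˡ-⊆ : ∀ {n} {p q : Subset n} s → p ⊆ q → p ∩ s ⊆ q ∩ s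
∩-monoˡ-⊆ {p = p} s p⊆q x∈p∩s with x∈p , x∈s ← x∈p∩q⁻ p s x∈p∩s = x∈p∩q⁺ (p⊆q x∈p , x∈s)

p⊆q⇒p∩q≡p : ∀ {n} {p q : Subset n} → p ⊆ q → p ∩ q ≡ p
p⊆q⇒p∩q≡p {p = p} {q} p⊆q = ⊆-antisym (p∩q⊆p p q) (λ x∈p → x∈p∩q⁺ (x∈p , p⊆q x∈p))

q⊆p⇒p∪q≡p : ∀ {n} {p q : Subset n} → q ⊆ p → p ∪ q ≡ p
q⊆p⇒p∪q≡p {p = p} {q} q⊆p = ⊆-antisym p∪q⊆p (p⊆p∪q q)
  where
  p∪q⊆p : p ∪ q ⊆ p
  p∪q⊆p x∈p∪q with x∈p∪q⁻ p q x∈p∪q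
  ... | inj₁ x∈p = x∈p
  ... | inj₂ x∈q = q⊆p x∈q

x∈p⇒p∪⁅x⁆≡p : ∀ {n} {x : Fin n} {p} → x ∈ p → p ∪ ⁅ x ⁆ ≡ p
x∈p⇒p∪⁅x⁆≡p {x = x} {p} x∈p = q⊆p⇒p∪q≡p (λ y∈⁅x⁆ → subst (_∈ p) (sym (x∈⁅y⁆⇒x≡y x y∈⁅x⁆)) x∈p)

lookup-∪ : ∀ {n} (p q : Subset n) i → lookup (p ∪ q) i ≡ lookup p i ∨ lookup q i
lookup-∪ p q i = lookup-zipWith _∨_ i p q

lookup-∩ : ∀ {n} (p q : Subset n) i → lookup (p ∩ q) i ≡ lookup p i ∧ lookup q i
lookup-∩ p q i = lookup-zipWith _∧_ i p q

lookup-∪⁅x⁆-≢ : ∀ {n} {x i : Fin n} (p : Subset n) → i ≢ x → lookup (p ∪ ⁅ x ⁆) i ≡ lookup p i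
lookup-∪⁅x⁆-≢ {x = x} {i} p i≢x = begin
  lookup (p ∪ ⁅ x ⁆) i         ≡⟨ lookup-∪ p ⁅ x ⁆ i ⟩
  lookup p i ∨ lookup ⁅ x ⁆ i  ≡⟨ cong (lookup p i ∨_) (∉⇒lookup (x≢y⇒x∉⁅y⁆ i≢x)) ⟩
  lookup p i ∨ false           ≡⟨ Bool.∨-identityʳ _ ⟩
  lookup p i                   ∎
  where open ≡-Reasoning

weightOn : ∀ {n} → (Fin n → ℕ) → Subset n → Fin n → ℕ
weightOn W A e = if lookup A e then W e else 0

weight : ∀ {n} → (Fin n → ℕ) → Subset n → ℕ
weight W A = sum (weightOn W A)

weight-modular : ∀ {n} (W : Fin n → ℕ) A B →
                 weight W (A ∪ B) + weight W (A ∩ B) ≡ weight W A + weight W B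
weight-modular W A B = begin
  weight W (A ∪ B) + weight W (A ∩ B)                  ≡⟨ ∑-distrib-+ (weightOn W (A ∪ B)) _ ⟨
  ∑[ e < _ ] (weightOn W (A ∪ B) e + weightOn W (A ∩ B) e) ≡⟨ sum-cong-≗ pointwise ⟩
  ∑[ e < _ ] (weightOn W A e + weightOn W B e)             ≡⟨ ∑-distrib-+ (weightOn W A) _ ⟩
  weight W A + weight W B                              ∎
  where
  open ≡-Reasoning
  pointwise : ∀ e → weightOn W (A ∪ B) e + weightOn W (A ∩ B) e ≡ weightOn W A e + weightOn W B e
  pointwise e rewrite lookup-∪ A B e | lookup-∩ A B e with lookup A e | lookup B e
  ... | true  | true  = refl
  ... | true  | false = refl
  ... | false | true  = +-identityʳ _
  ... | false | false = refl

weightOn-∈ : ∀ {n} (W : Fin n → ℕ) {x A} → x ∈ A → weightOn W A x ≡ W x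
weightOn-∈ W x∈A = cong (if_then W _ else 0) (∈⇒lookup x∈A)

weightOn-∉ : ∀ {n} (W : Fin n → ℕ) {x A} → x ∉ A → weightOn W A x ≡ 0
weightOn-∉ W x∉A = cong (if_then W _ else 0) (∉⇒lookup x∉A)

weight-∪⁅x⁆ : ∀ {n} (W : Fin n → ℕ) {x A} → x ∉ A → weight W (A ∪ ⁅ x ⁆) ≡ weight W A + W x
weight-∪⁅x⁆ W {x} {A} x∉A = begin
  weight W (A ∪ ⁅ x ⁆)                    ≡⟨ +-identityʳ _ ⟨
  weight W (A ∪ ⁅ x ⁆) + 0                ≡⟨ cong (weight W (A ∪ ⁅ x ⁆) +_) (weightOn-∉ W x∉A) ⟨
  weight W (A ∪ ⁅ x ⁆) + weightOn W A x   ≡⟨ ∑-update (weightOn W (A ∪ ⁅ x ⁆)) (weightOn W A) x agree ⟩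
  weight W A + weightOn W (A ∪ ⁅ x ⁆) x   ≡⟨ cong (weight W A +_) (weightOn-∈ W (q⊆p∪q A ⁅ x ⁆ (x∈⁅x⁆ x))) ⟩
  weight W A + W x                        ∎
  where
  open ≡-Reasoning
  agree : ∀ j → j ≢ x → weightOn W (A ∪ ⁅ x ⁆) j ≡ weightOn W A j
  agree j j≢x = cong (if_then W j else 0) (lookup-∪⁅x⁆-≢ A j≢x)

-- Matroids, restriction and contraction

module _ {n} (M : Matroid n) where

  r-⊥ : r M ⊥ ≡ 0
  r-⊥ = n≤0⇒n≡0 (≤-trans (r-bounded M ⊥) (≤-reflexive (∣⊥∣≡0 n)))

  ⊥-independent : Independent M ⊥
  ⊥-independent = trans r-⊥ (sym (∣⊥∣≡0 n))

  r-subadditive : ∀ A B → r M (A ∪ B) ≤ r M A + r M B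
  r-subadditive A B = ≤-trans (m≤m+n _ _) (r-submod M A B)

  independent-∩ : ∀ {C} → Independent M C → ∀ A → Independent M (C ∩ A)
  independent-∩ {C} C-indep A = ≤-antisym (r-bounded M (C ∩ A)) (+-cancelʳ-≤ ∣ C ∩ ∁ A ∣ _ _ (begin
    ∣ C ∩ A ∣ + ∣ C ∩ ∁ A ∣                   ≡⟨ ∣p∣≡∣p∩q∣+∣p∩∁q∣ C A ⟨
    ∣ C ∣                                     ≡⟨ C-indep ⟨
    r M C                                     ≡⟨ cong (r M) (p∩q∪p∩∁q≡p C A) ⟨
    r M ((C ∩ A) ∪ (C ∩ ∁ A))                 ≤⟨ r-subadditive (C ∩ A) (C ∩ ∁ A) ⟩
    r M (C ∩ A) + r M (C ∩ ∁ A)               ≤⟨ +-monoʳ-≤ _ (r-bounded M (C ∩ ∁ A)) ⟩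
    r M (C ∩ A) + ∣ C ∩ ∁ A ∣                 ∎))
    where
    open ≤-Reasoning

  Spans : Subset n → Fin n → Set
  Spans A e = r M (A ∪ ⁅ e ⁆) ≤ r M A

  Spans-mono : ∀ {G U} e → G ⊆ U → Spans G e → Spans U e
  Spans-mono {G} {U} e G⊆U G-spans = +-cancelʳ-≤ (r M G) _ _ (begin
    r M (U ∪ ⁅ e ⁆) + r M G                       ≤⟨ +-monoʳ-≤ _ (r-mono M _ _ G⊆U∩G+e) ⟩
    r M (U ∪ ⁅ e ⁆) + r M (U ∩ (G ∪ ⁅ e ⁆))       ≡⟨ cong (λ X → r M X + r M (U ∩ (G ∪ ⁅ e ⁆))) U∪G+e ⟨
    r M (U ∪ (G ∪ ⁅ e ⁆)) + r M (U ∩ (G ∪ ⁅ e ⁆)) ≤⟨ r-submod M U (G ∪ ⁅ e ⁆) ⟩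
    r M U + r M (G ∪ ⁅ e ⁆)                       ≤⟨ +-monoʳ-≤ _ G-spans ⟩
    r M U + r M G                                 ∎)
    where
    open ≤-Reasoning
    G⊆U∩G+e : G ⊆ U ∩ (G ∪ ⁅ e ⁆)
    G⊆U∩G+e x∈G = x∈p∩q⁺ (G⊆U x∈G , p⊆p∪q ⁅ e ⁆ x∈G)
    U∪G+e : U ∪ (G ∪ ⁅ e ⁆) ≡ U ∪ ⁅ e ⁆
    U∪G+e = trans (sym (∪-assoc U G ⁅ e ⁆)) (cong (_∪ ⁅ e ⁆) (q⊆p⇒p∪q≡p G⊆U))

restrict : ∀ {n} → Matroid n → Subset n → Matroid n
restrict M S = record
  { r         = λ A → r M (A ∩ S)
  ; r-bounded = λ A → ≤-trans (r-bounded M (A ∩ S)) (∣p∩q∣≤∣p∣ A S)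
  ; r-mono    = λ A B A⊆B → r-mono M _ _ (∩-monoˡ-⊆ S A⊆B)
  ; r-submod  = λ A B → subst₂ (λ X Y → r M X + r M Y ≤ r M (A ∩ S) + r M (B ∩ S))
                  (sym (∩-distribʳ-∪ S A B)) (sym (∩-Properties.∙-distrʳ-∙ S A B))
                  (r-submod M (A ∩ S) (B ∩ S))
  }

independent-restrict : ∀ {n} (M : Matroid n) S {C} →
                       Independent (restrict M S) C → C ⊆ S × Independent M C
independent-restrict M S {C} C-indep = C⊆S , trans (cong (r M) (sym (p⊆q⇒p∩q≡p C⊆S))) C-indep
  where
  C⊆S : C ⊆ S
  C⊆S = ∣p∣≤∣p∩q∣⇒p⊆q C S (subst (_≤ ∣ C ∩ S ∣) C-indep (r-bounded M (C ∩ S)))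

module _ {n} (M : Matroid n) (e : Fin n) (e-nonloop : 1 ≤ r M ⁅ e ⁆) where

  private
    r/e : Subset n → ℕ
    r/e A = r M (A ∪ ⁅ e ⁆) ∸ 1

    r/e+1 : ∀ A → r/e A + 1 ≡ r M (A ∪ ⁅ e ⁆)
    r/e+1 A = m∸n+n≡m (≤-trans e-nonloop (r-mono M _ _ (q⊆p∪q A ⁅ e ⁆)))

  contract : Matroid n
  contract = record
    { r         = r/e
    ; r-bounded = bounded
    ; r-mono    = λ A B A⊆B → ∸-monoˡ-≤ 1 (r-mono M _ _ (∪-monoˡ-⊆ ⁅ e ⁆ A⊆B))
    ; r-submod  = submod
    }
    where
    open ≤-Reasoning
    bounded : ∀ A → r/e A ≤ ∣ A ∣
    bounded A = +-cancelʳ-≤ 1 _ _ (begin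
      r/e A + 1            ≡⟨ r/e+1 A ⟩
      r M (A ∪ ⁅ e ⁆)      ≤⟨ r-subadditive M A ⁅ e ⁆ ⟩
      r M A + r M ⁅ e ⁆    ≤⟨ +-mono-≤ (r-bounded M A) (≤-trans (r-bounded M ⁅ e ⁆) (≤-reflexive (∣⁅x⁆∣≡1 e))) ⟩
      ∣ A ∣ + 1            ∎)
    submod : ∀ A B → r/e (A ∪ B) + r/e (A ∩ B) ≤ r/e A + r/e B
    submod A B = +-cancelʳ-≤ 2 _ _ (begin
      r/e (A ∪ B) + r/e (A ∩ B) + (1 + 1)                   ≡⟨ interchange (r/e (A ∪ B)) _ 1 1 ⟩
      (r/e (A ∪ B) + 1) + (r/e (A ∩ B) + 1)                 ≡⟨ cong₂ _+_ (r/e+1 (A ∪ B)) (r/e+1 (A ∩ B)) ⟩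
      r M ((A ∪ B) ∪ ⁅ e ⁆) + r M ((A ∩ B) ∪ ⁅ e ⁆)         ≡⟨ cong₂ (λ X Y → r M X + r M Y)
                                                                  (∪-Properties.∙-distrʳ-∙ ⁅ e ⁆ A B) (∪-distribʳ-∩ ⁅ e ⁆ A B) ⟩
      r M ((A ∪ ⁅ e ⁆) ∪ (B ∪ ⁅ e ⁆)) + r M ((A ∪ ⁅ e ⁆) ∩ (B ∪ ⁅ e ⁆)) ≤⟨ r-submod M (A ∪ ⁅ e ⁆) (B ∪ ⁅ e ⁆) ⟩
      r M (A ∪ ⁅ e ⁆) + r M (B ∪ ⁅ e ⁆)                     ≡⟨ cong₂ _+_ (r/e+1 A) (r/e+1 B) ⟨
      (r/e A + 1) + (r/e B + 1)                             ≡⟨ interchange (r/e A) 1 (r/e B) 1 ⟩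
      r/e A + r/e B + (1 + 1)                               ∎)

  r-contract : ∀ A → r contract A + 1 ≡ r M (A ∪ ⁅ e ⁆)
  r-contract = r/e+1

  independent-contract : ∀ {C} → Independent contract C → e ∉ C × Independent M (C ∪ ⁅ e ⁆)
  independent-contract {C} C-indep = e∉C , C+e-indep
    where
    r[C+e]≡∣C∣+1 : r M (C ∪ ⁅ e ⁆) ≡ ∣ C ∣ + 1
    r[C+e]≡∣C∣+1 = trans (sym (r-contract C)) (cong (_+ 1) C-indep)
    e∉C : e ∉ C
    e∉C e∈C = <-irrefl refl (begin-strict
      ∣ C ∣            <⟨ m<m+n ∣ C ∣ z<s ⟩
      ∣ C ∣ + 1        ≡⟨ r[C+e]≡∣C∣+1 ⟨
      r M (C ∪ ⁅ e ⁆)  ≡⟨ cong (r M) (x∈p⇒p∪⁅x⁆≡p e∈C) ⟩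
      r M C            ≤⟨ r-bounded M C ⟩
      ∣ C ∣            ∎)
      where open ≤-Reasoning
    C+e-indep : Independent M (C ∪ ⁅ e ⁆)
    C+e-indep = trans r[C+e]≡∣C∣+1 (trans (+-comm ∣ C ∣ 1) (sym (∣p∪⁅x⁆∣≡1+∣p∣ C e∉C)))

update : ∀ {A X : Set} → DecidableEquality A → (A → X) → A → X → A → X
update _≟ᴬ_ f a x b = if does (b ≟ᴬ a) then x else f b

module _ {A X : Set} (_≟ᴬ_ : DecidableEquality A) (f : A → X) (a : A) (x : X) where

  update-≡ : update _≟ᴬ_ f a x a ≡ x
  update-≡ = cong (if_then x else f a) (dec-true (a ≟ᴬ a) refl)

  update-≢ : ∀ {b} → b ≢ a → update _≟ᴬ_ f a x b ≡ f b
  update-≢ {b} b≢a = cong (if_then x else f b) (dec-false (b ≟ᴬ a) b≢a)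

update-elim : ∀ {A X : Set} (_≟ᴬ_ : DecidableEquality A) (P : A → X → Set) {f : A → X} {a x} →
              P a x → (∀ b → b ≢ a → P b (f b)) → ∀ b → P b (update _≟ᴬ_ f a x b)
update-elim _≟ᴬ_ P {a = a} Pa Pf b with b ≟ᴬ a
... | yes refl = Pa
... | no  b≢a  = Pf b b≢a

lookup-colourClass : ∀ {n} (L : Fin n → List ℕ) c x → lookup (colourClass L c) x ≡ does (c ∈ˡ? L x)
lookup-colourClass L c x = trans (lookup∘tabulate _ x) (if-then-true-else-false (does (c ∈ˡ? L x)))
  where
  if-then-true-else-false : ∀ b → (if b then true else false) ≡ b
  if-then-true-else-false true  = refl
  if-then-true-else-false false = refl

∈-colourClass⁺ : ∀ {n} {L : Fin n → List ℕ} {c x} → c ∈ˡ L x → x ∈ colourClass L c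
∈-colourClass⁺ {L = L} {c} {x} c∈Lx =
  lookup⇒∈ (trans (lookup-colourClass L c x) (dec-true (c ∈ˡ? L x) c∈Lx))

∈-colourClass⁻ : ∀ {n} {L : Fin n → List ℕ} {c x} → x ∈ colourClass L c → c ∈ˡ L x
∈-colourClass⁻ {L = L} {c} {x} x∈C with c ∈ˡ? L x | lookup-colourClass L c x
... | yes c∈Lx | _ = c∈Lx
... | no  _    | C[x]≡false with () ← trans (sym C[x]≡false) (∈⇒lookup x∈C)

colourClass-[] : ∀ {n} c → colourClass {n} (λ _ → []) c ≡ ⊥
colourClass-[] {zero}  c = refl
colourClass-[] {suc n} c = cong (outside ∷_) (colourClass-[] c)

module _ {n} (L : Fin n → List ℕ) (e : Fin n) (c : ℕ) where

  private
    L⁺ : Fin n → List ℕ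
    L⁺ = update Fin._≟_ L e (c ∷ L e)

  colourClass-add : colourClass L⁺ c ≡ colourClass L c ∪ ⁅ e ⁆
  colourClass-add = lookup-injective pointwise
    where
    pointwise : ∀ x → lookup (colourClass L⁺ c) x ≡ lookup (colourClass L c ∪ ⁅ e ⁆) x
    pointwise x with x Fin.≟ e
    ... | yes refl = begin
      lookup (colourClass L⁺ c) e               ≡⟨ ∈⇒lookup (∈-colourClass⁺ {L = L⁺} c∈L⁺e) ⟩
      true                                      ≡⟨ ∈⇒lookup (q⊆p∪q (colourClass L c) ⁅ e ⁆ (x∈⁅x⁆ e)) ⟨
      lookup (colourClass L c ∪ ⁅ e ⁆) e        ∎
      where
      open ≡-Reasoning
      c∈L⁺e : c ∈ˡ L⁺ e
      c∈L⁺e = subst (c ∈ˡ_) (sym (update-≡ Fin._≟_ L e (c ∷ L e))) (Any.here refl)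
    ... | no x≢e = begin
      lookup (colourClass L⁺ c) x               ≡⟨ lookup-colourClass L⁺ c x ⟩
      does (c ∈ˡ? L⁺ x)                         ≡⟨ cong (λ xs → does (c ∈ˡ? xs)) (update-≢ Fin._≟_ L e (c ∷ L e) x≢e) ⟩
      does (c ∈ˡ? L x)                          ≡⟨ lookup-colourClass L c x ⟨
      lookup (colourClass L c) x                ≡⟨ lookup-∪⁅x⁆-≢ (colourClass L c) x≢e ⟨
      lookup (colourClass L c ∪ ⁅ e ⁆) x        ∎
      where open ≡-Reasoning

  colourClass-add-≢ : ∀ {c′} → c′ ≢ c → colourClass L⁺ c′ ≡ colourClass L c′
  colourClass-add-≢ {c′} c′≢c = lookup-injective λ x →
    trans (lookup-colourClass L⁺ c′ x) (trans (pointwise x) (sym (lookup-colourClass L c′ x)))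
    where
    pointwise : ∀ x → does (c′ ∈ˡ? L⁺ x) ≡ does (c′ ∈ˡ? L x)
    pointwise x with x Fin.≟ e
    ... | yes refl = cong (_∨ does (c′ ∈ˡ? L x)) (dec-false (c′ ≟ c) c′≢c)
    ... | no  _    = refl

-- The covering theorem

balance : ∀ {x a y b} d → x + a ≡ y + b → a ≤ b + d → y ≤ x + d
balance {x} {a} {y} {b} d x+a≡y+b a≤b+d = +-cancelʳ-≤ a _ _ (begin
  y + a        ≤⟨ +-monoʳ-≤ y a≤b+d ⟩
  y + (b + d)  ≡⟨ +-assoc y b d ⟨
  y + b + d    ≡⟨ cong (_+ d) x+a≡y+b ⟨
  x + a + d    ≡⟨ xy∙z≈xz∙y x a d ⟩
  x + d + a    ∎)
  where open ≤-Reasoning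

union : ∀ {n K} → (Fin K → Subset n) → Subset n
union {K = zero}  g = ⊥
union {K = suc K} g = g zero ∪ union (g ∘ suc)

⊆-union : ∀ {n K} (g : Fin K → Subset n) c → g c ⊆ union g
⊆-union g zero    = p⊆p∪q (union (g ∘ suc))
⊆-union g (suc c) = q⊆p∪q (g zero) _ ∘ ⊆-union (g ∘ suc) c

union-closed : ∀ {n} (P : Subset n → Set) → P ⊥ → (∀ {A B} → P A → P B → P (A ∪ B)) →
               ∀ {K} (g : Fin K → Subset n) → (∀ c → P (g c)) → P (union g)
union-closed P P⊥ P∪ {zero}  g Pg = P⊥
union-closed P P⊥ P∪ {suc K} g Pg = P∪ (Pg zero) (union-closed P P⊥ P∪ (g ∘ suc) (Pg ∘ suc))

Covering : ∀ {n} → (ℕ → Matroid n) → (Fin n → ℕ) → Set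
Covering {n} Ms W = Σ (Fin n → List ℕ) λ L′ →
    (∀ e → Unique (L′ e) × length (L′ e) ≡ W e)
  × (∀ c → Independent (Ms c) (colourClass L′ c))

totalRank : ∀ {n} → (ℕ → Matroid n) → ℕ → Subset n → ℕ
totalRank Ms K A = ∑[ c < K ] r (Ms (toℕ c)) A

module _ {n} (Ms : ℕ → Matroid n) (K : ℕ) where

  totalRank-⊥ : totalRank Ms K ⊥ ≡ 0
  totalRank-⊥ = trans (sum-cong-≗ {K} (λ c → r-⊥ (Ms (toℕ c)))) (sum-replicate-zero K)

  totalRank-submodular : ∀ A B → totalRank Ms K (A ∪ B) + totalRank Ms K (A ∩ B)
                                 ≤ totalRank Ms K A + totalRank Ms K B
  totalRank-submodular A B = begin
    totalRank Ms K (A ∪ B) + totalRank Ms K (A ∩ B)     ≡⟨ ∑-distrib-+ {K} (λ c → r (Ms (toℕ c)) (A ∪ B)) _ ⟨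
    ∑[ c < K ] (r (Ms (toℕ c)) (A ∪ B) + r (Ms (toℕ c)) (A ∩ B)) ≤⟨ ∑-mono-≤ {K} (λ c → r-submod (Ms (toℕ c)) A B) ⟩
    ∑[ c < K ] (r (Ms (toℕ c)) A + r (Ms (toℕ c)) B)   ≡⟨ ∑-distrib-+ {K} (λ c → r (Ms (toℕ c)) A) _ ⟩
    totalRank Ms K A + totalRank Ms K B                 ∎
    where open ≤-Reasoning

module CoveringStep {n} (Ms : ℕ → Matroid n) (K : ℕ) (W : Fin n → ℕ)
                    (rank-condition : ∀ A → weight W A ≤ totalRank Ms K A)
                    (e : Fin n) (w : ℕ) (We : W e ≡ suc w) where

  Tight : Subset n → Set
  Tight A = totalRank Ms K A ≤ weight W A

  ⊥-tight : Tight ⊥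
  ⊥-tight = ≤-trans (≤-reflexive (totalRank-⊥ Ms K)) z≤n

  tight-∪ : ∀ {A B} → Tight A → Tight B → Tight (A ∪ B)
  tight-∪ {A} {B} A-tight B-tight = +-cancelʳ-≤ (totalRank Ms K (A ∩ B)) _ _ (begin
    totalRank Ms K (A ∪ B) + totalRank Ms K (A ∩ B)  ≤⟨ totalRank-submodular Ms K A B ⟩
    totalRank Ms K A + totalRank Ms K B              ≤⟨ +-mono-≤ A-tight B-tight ⟩
    weight W A + weight W B                          ≡⟨ weight-modular W A B ⟨
    weight W (A ∪ B) + weight W (A ∩ B)              ≤⟨ +-monoʳ-≤ _ (rank-condition (A ∩ B)) ⟩
    weight W (A ∪ B) + totalRank Ms K (A ∩ B)        ∎)
    where open ≤-Reasoning

  Blocks : ℕ → Subset n → Set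
  Blocks c A = e ∉ A × Tight A × Spans (Ms c) A e

  blocks? : ∀ c A → Dec (Blocks c A)
  blocks? c A = ¬? (e ∈? A) ×-dec (_ ≤? _) ×-dec (_ ≤? _)

  Free : Fin K → Set
  Free c = ¬ ∃ (Blocks (toℕ c))

  -- The union of blocking sets is tight, avoids e and spans e in every colour, so
  -- adding e would violate the rank condition.
  some-colour-free : ∃ Free
  some-colour-free with any? (λ c → ¬? (anySubset? (blocks? (toℕ c))))
  ... | yes free = free
  ... | no  none = ⊥-elim (<-irrefl refl (begin-strict
    weight W U                  <⟨ m<m+n (weight W U) (subst (0 <_) (sym We) z<s) ⟩
    weight W U + W e            ≡⟨ weight-∪⁅x⁆ W e∉U ⟨
    weight W (U ∪ ⁅ e ⁆)        ≤⟨ rank-condition (U ∪ ⁅ e ⁆) ⟩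
    totalRank Ms K (U ∪ ⁅ e ⁆)  ≤⟨ ∑-mono-≤ (λ c → Spans-mono (Ms (toℕ c)) e (⊆-union B c) (spans c)) ⟩
    totalRank Ms K U            ≤⟨ union-closed Tight ⊥-tight tight-∪ B B-tight ⟩
    weight W U                  ∎))
    where
    open ≤-Reasoning
    blocked : ∀ c → ∃ (Blocks (toℕ c))
    blocked c = decidable-stable (anySubset? (blocks? (toℕ c))) (λ unblocked → none (c , unblocked))
    B : Fin K → Subset n
    B = proj₁ ∘ blocked
    e∉B : ∀ c → e ∉ B c
    e∉B c = proj₁ (proj₂ (blocked c))
    B-tight : ∀ c → Tight (B c)
    B-tight c = proj₁ (proj₂ (proj₂ (blocked c)))
    spans : ∀ c → Spans (Ms (toℕ c)) (B c) e
    spans c = proj₂ (proj₂ (proj₂ (blocked c)))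
    U : Subset n
    U = union B
    e∉U : e ∉ U
    e∉U = union-closed (e ∉_) ∉⊥ (λ e∉A e∉B e∈A∪B → [ e∉A , e∉B ]′ (x∈p∪q⁻ _ _ e∈A∪B)) B e∉B

  module Recolour (c : Fin K) (free : Free c) where

    Mc : Matroid n
    Mc = Ms (toℕ c)

    e-nonloop : 1 ≤ r Mc ⁅ e ⁆
    e-nonloop with 1 ≤? r Mc ⁅ e ⁆
    ... | yes 1≤r[e]    = 1≤r[e]
    ... | no  e-loop    = ⊥-elim (free (⊥ , ∉⊥ , ⊥-tight , ⊥-spans))
      where
      ⊥-spans : Spans Mc ⊥ e
      ⊥-spans = begin
        r Mc (⊥ ∪ ⁅ e ⁆)  ≡⟨ cong (r Mc) (∪-identityˡ ⁅ e ⁆) ⟩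
        r Mc ⁅ e ⁆        ≤⟨ ≤-pred (≰⇒> e-loop) ⟩
        0                 ≡⟨ r-⊥ Mc ⟨
        r Mc ⊥            ∎
        where open ≤-Reasoning

    Mc/e : Matroid n
    Mc/e = contract Mc e e-nonloop

    Ms′ : ℕ → Matroid n
    Ms′ = update _≟_ Ms (toℕ c) Mc/e

    W′ : Fin n → ℕ
    W′ = update Fin._≟_ W e w

    totalRank-update : ∀ A → totalRank Ms′ K A + r Mc A ≡ totalRank Ms K A + r Mc/e A
    totalRank-update A =
      trans (∑-update (λ j → r (Ms′ (toℕ j)) A) (λ j → r (Ms (toℕ j)) A) c agree)
            (cong (λ M → totalRank Ms K A + r M A) (update-≡ _≟_ Ms (toℕ c) Mc/e))
      where
      agree : ∀ j → j ≢ c → r (Ms′ (toℕ j)) A ≡ r (Ms (toℕ j)) A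
      agree j j≢c = cong (λ M → r M A) (update-≢ _≟_ Ms (toℕ c) Mc/e (j≢c ∘ Fin.toℕ-injective))

    weight-update : ∀ A → weight W′ A + weightOn W A e ≡ weight W A + weightOn W′ A e
    weight-update A = ∑-update (weightOn W′ A) (weightOn W A) e
      (λ x x≢e → cong (if lookup A x then_else 0) (update-≢ Fin._≟_ W e w x≢e))

    weight′-∈ : ∀ {A} → e ∈ A → weight W′ A + 1 ≡ weight W A
    weight′-∈ {A} e∈A = +-cancelʳ-≡ w _ _ (begin
      weight W′ A + 1 + w             ≡⟨ +-assoc (weight W′ A) 1 w ⟩
      weight W′ A + suc w             ≡⟨ cong (weight W′ A +_) We ⟨
      weight W′ A + W e               ≡⟨ cong (weight W′ A +_) (weightOn-∈ W e∈A) ⟨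
      weight W′ A + weightOn W A e    ≡⟨ weight-update A ⟩
      weight W A + weightOn W′ A e    ≡⟨ cong (weight W A +_) (weightOn-∈ W′ e∈A) ⟩
      weight W A + W′ e               ≡⟨ cong (weight W A +_) (update-≡ Fin._≟_ W e w) ⟩
      weight W A + w                  ∎)
      where open ≡-Reasoning

    weight′-∉ : ∀ {A} → e ∉ A → weight W′ A ≡ weight W A
    weight′-∉ {A} e∉A = begin
      weight W′ A                     ≡⟨ +-identityʳ _ ⟨
      weight W′ A + 0                 ≡⟨ cong (weight W′ A +_) (weightOn-∉ W e∉A) ⟨
      weight W′ A + weightOn W A e    ≡⟨ weight-update A ⟩
      weight W A + weightOn W′ A e    ≡⟨ cong (weight W A +_) (weightOn-∉ W′ e∉A) ⟩
      weight W A + 0                  ≡⟨ +-identityʳ _ ⟩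
      weight W A                      ∎
      where open ≡-Reasoning

    sum-W′ : ∀ {k} → sum W ≡ suc k → sum W′ ≡ k
    sum-W′ {k} ∑W≡1+k = +-cancelʳ-≡ w _ _ (suc-injective (begin
      suc (sum W′ + w)  ≡⟨ +-suc (sum W′) w ⟨
      sum W′ + suc w    ≡⟨ cong (sum W′ +_) We ⟨
      sum W′ + W e      ≡⟨ ∑-update W′ W e (λ x x≢e → update-≢ Fin._≟_ W e w x≢e) ⟩
      sum W + W′ e      ≡⟨ cong₂ _+_ ∑W≡1+k (update-≡ Fin._≟_ W e w) ⟩
      suc k + w         ∎))
      where open ≡-Reasoning

    r≡r/e+1 : ∀ {A} → e ∈ A → r Mc A ≡ r Mc/e A + 1
    r≡r/e+1 {A} e∈A = trans (cong (r Mc) (sym (x∈p⇒p∪⁅x⁆≡p e∈A))) (sym (r-contract Mc e e-nonloop A))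

    r≤r/e+1 : ∀ A → r Mc A ≤ r Mc/e A + 1
    r≤r/e+1 A = ≤-trans (r-mono Mc _ _ (p⊆p∪q ⁅ e ⁆)) (≤-reflexive (sym (r-contract Mc e e-nonloop A)))

    r≤r/e+0 : ∀ {A} → e ∉ A → Tight A → r Mc A ≤ r Mc/e A + 0
    r≤r/e+0 {A} e∉A tight = +-cancelʳ-≤ 1 _ _ (begin
      r Mc A + 1            ≡⟨ +-comm (r Mc A) 1 ⟩
      suc (r Mc A)          ≤⟨ ≰⇒> (λ spans → free (A , e∉A , tight , spans)) ⟩
      r Mc (A ∪ ⁅ e ⁆)      ≡⟨ r-contract Mc e e-nonloop A ⟨
      r Mc/e A + 1          ≡⟨ cong (_+ 1) (+-identityʳ _) ⟨
      r Mc/e A + 0 + 1      ∎)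
      where open ≤-Reasoning

    -- If e ∈ A both sides drop by one; if A is tight the rank in colour c does not drop;
    -- otherwise the slack absorbs the drop.
    rank-condition′ : ∀ A → weight W′ A ≤ totalRank Ms′ K A
    rank-condition′ A with e ∈? A
    ... | yes e∈A = +-cancelʳ-≤ 1 _ _ (begin
      weight W′ A + 1         ≡⟨ weight′-∈ e∈A ⟩
      weight W A              ≤⟨ rank-condition A ⟩
      totalRank Ms K A        ≤⟨ balance 1 (totalRank-update A) (≤-reflexive (r≡r/e+1 e∈A)) ⟩
      totalRank Ms′ K A + 1   ∎)
      where open ≤-Reasoning
    ... | no e∉A with totalRank Ms K A ≤? weight W A
    ...   | yes tight = begin
      weight W′ A             ≡⟨ weight′-∉ e∉A ⟩
      weight W A              ≤⟨ rank-condition A ⟩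
      totalRank Ms K A        ≤⟨ balance 0 (totalRank-update A) (r≤r/e+0 e∉A tight) ⟩
      totalRank Ms′ K A + 0   ≡⟨ +-identityʳ _ ⟩
      totalRank Ms′ K A       ∎
      where open ≤-Reasoning
    ...   | no slack = +-cancelʳ-≤ 1 _ _ (begin
      weight W′ A + 1         ≡⟨ cong (_+ 1) (weight′-∉ e∉A) ⟩
      weight W A + 1          ≡⟨ +-comm (weight W A) 1 ⟩
      suc (weight W A)        ≤⟨ ≰⇒> slack ⟩
      totalRank Ms K A        ≤⟨ balance 1 (totalRank-update A) (r≤r/e+1 A) ⟩
      totalRank Ms′ K A + 1   ∎)
      where open ≤-Reasoning

    extend : Covering Ms′ W′ → Covering Ms W
    extend (L″ , sizes , independent) = L′ , sizes′ , independent′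
      where
      C : Subset n
      C = colourClass L″ (toℕ c)

      C-independent/e : Independent Mc/e C
      C-independent/e = subst (λ M → Independent M C) (update-≡ _≟_ Ms (toℕ c) Mc/e) (independent (toℕ c))

      e∉C : e ∉ C
      e∉C = proj₁ (independent-contract Mc e e-nonloop C-independent/e)

      C+e-independent : Independent Mc (C ∪ ⁅ e ⁆)
      C+e-independent = proj₂ (independent-contract Mc e e-nonloop C-independent/e)

      L′ : Fin n → List ℕ
      L′ = update Fin._≟_ L″ e (toℕ c ∷ L″ e)

      sizes′ : ∀ x → Unique (L′ x) × length (L′ x) ≡ W x
      sizes′ = update-elim Fin._≟_ (λ x xs → Unique xs × length xs ≡ W x)
        ( ¬Any⇒All¬ (L″ e) (e∉C ∘ ∈-colourClass⁺ {L = L″}) AllPairs.∷ proj₁ (sizes e)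
        , trans (cong suc (trans (proj₂ (sizes e)) (update-≡ Fin._≟_ W e w))) (sym We) )
        (λ x x≢e → proj₁ (sizes x) , trans (proj₂ (sizes x)) (update-≢ Fin._≟_ W e w x≢e))

      independent′ : ∀ c′ → Independent (Ms c′) (colourClass L′ c′)
      independent′ c′ with c′ ≟ toℕ c
      ... | yes refl = subst (Independent Mc) (sym (colourClass-add L″ e (toℕ c))) C+e-independent
      ... | no  c′≢c = subst₂ Independent (update-≢ _≟_ Ms (toℕ c) Mc/e c′≢c)
                         (sym (colourClass-add-≢ L″ e (toℕ c) c′≢c)) (independent c′)

covering-theorem : ∀ {n} (Ms : ℕ → Matroid n) K (W : Fin n → ℕ) →
                   (∀ A → weight W A ≤ totalRank Ms K A) → Covering Ms W
covering-theorem Ms K W = covering (sum W) Ms W refl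
  where
  covering : ∀ k {n} (Ms : ℕ → Matroid n) (W : Fin n → ℕ) → sum W ≡ k →
             (∀ A → weight W A ≤ totalRank Ms K A) → Covering Ms W
  covering zero Ms W ∑W≡0 _ =
      (λ _ → [])
    , (λ x → AllPairs.[] , sym (n≤0⇒n≡0 (subst (W x ≤_) ∑W≡0 (≤-∑ W x))))
    , (λ c → subst (Independent (Ms c)) (sym (colourClass-[] c)) (⊥-independent (Ms c)))
  covering (suc k) Ms W ∑W≡1+k rank-condition
    with e , w , We ← ∑≡suc⇒nonzero W ∑W≡1+k
    with c , free ← CoveringStep.some-colour-free Ms K W rank-condition e w We =
    extend (covering k Ms′ W′ (sum-W′ ∑W≡1+k) rank-condition′)
    where open CoveringStep.Recolour Ms K W rank-condition e w We c free

-- The rearrangement inequality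

superlevel : ∀ {n} → (Fin n → ℕ) → ℕ → Subset n
superlevel m i = tabulate (λ e → i ≤ᵇ m e)

levelRankSum : ∀ {n} → Matroid n → (Fin n → ℕ) → ℕ → ℕ
levelRankSum M m K = ∑[ i < K ] r M (superlevel m (suc (toℕ i)))

multiplicity : ∀ {n} → (ℕ → Subset n) → ℕ → Fin n → ℕ
multiplicity T K e = ∑[ c < K ] 𝟙 (lookup (T (toℕ c)) e)

module _ {n} (X : Subset n) (m : Fin n → ℕ) where

  private
    𝟙X+m : Fin n → ℕ
    𝟙X+m e = 𝟙 (lookup X e) + m e

  superlevel-𝟙+-1 : superlevel 𝟙X+m 1 ≡ X ∪ superlevel m 1
  superlevel-𝟙+-1 = lookup-injective λ e → begin
    lookup (superlevel 𝟙X+m 1) e               ≡⟨ lookup∘tabulate _ e ⟩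
    1 ≤ᵇ (𝟙 (lookup X e) + m e)                ≡⟨ pointwise (lookup X e) (m e) ⟩
    lookup X e ∨ (1 ≤ᵇ m e)                    ≡⟨ cong (lookup X e ∨_) (lookup∘tabulate _ e) ⟨
    lookup X e ∨ lookup (superlevel m 1) e     ≡⟨ lookup-∪ X (superlevel m 1) e ⟨
    lookup (X ∪ superlevel m 1) e              ∎
    where
    open ≡-Reasoning
    pointwise : ∀ b t → (1 ≤ᵇ (𝟙 b + t)) ≡ b ∨ (1 ≤ᵇ t)
    pointwise true  t = refl
    pointwise false t = refl

  superlevel-𝟙+-suc : ∀ i → superlevel 𝟙X+m (2 + i)
                          ≡ superlevel (λ e → 𝟙 (lookup (X ∩ superlevel m 1) e) + (m e ∸ 1)) (suc i)
  superlevel-𝟙+-suc i = lookup-injective λ e → begin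
    lookup (superlevel 𝟙X+m (2 + i)) e                                 ≡⟨ lookup∘tabulate _ e ⟩
    2 + i ≤ᵇ (𝟙 (lookup X e) + m e)                                    ≡⟨ pointwise (lookup X e) (m e) ⟩
    suc i ≤ᵇ (𝟙 (lookup X e ∧ (1 ≤ᵇ m e)) + (m e ∸ 1))                 ≡⟨ cong (λ b → suc i ≤ᵇ (𝟙 (lookup X e ∧ b) + (m e ∸ 1))) (lookup∘tabulate _ e) ⟨
    suc i ≤ᵇ (𝟙 (lookup X e ∧ lookup (superlevel m 1) e) + (m e ∸ 1))  ≡⟨ cong (λ b → suc i ≤ᵇ (𝟙 b + (m e ∸ 1))) (lookup-∩ X (superlevel m 1) e) ⟨
    suc i ≤ᵇ (𝟙 (lookup (X ∩ superlevel m 1) e) + (m e ∸ 1))           ≡⟨ lookup∘tabulate _ e ⟨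
    lookup (superlevel (λ e → 𝟙 (lookup (X ∩ superlevel m 1) e) + (m e ∸ 1)) (suc i)) e ∎
    where
    open ≡-Reasoning
    pointwise : ∀ b t → (2 + i ≤ᵇ (𝟙 b + t)) ≡ (suc i ≤ᵇ (𝟙 (b ∧ (1 ≤ᵇ t)) + (t ∸ 1)))
    pointwise true  zero    = refl
    pointwise false zero    = refl
    pointwise true  (suc t) = refl
    pointwise false (suc t) = refl

superlevel-∸1 : ∀ {n} (m : Fin n → ℕ) i → superlevel (λ e → m e ∸ 1) (suc i) ≡ superlevel m (2 + i)
superlevel-∸1 m i = lookup-injective λ e →
  trans (lookup∘tabulate _ e) (trans (pointwise (m e)) (sym (lookup∘tabulate _ e)))
  where
  pointwise : ∀ t → (suc i ≤ᵇ (t ∸ 1)) ≡ (2 + i ≤ᵇ t)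
  pointwise zero    = refl
  pointwise (suc t) = refl

-- Submodularity trades the bottom level X ∪ {m ≥ 1} of 𝟙_X + m and the set X ∩ {m ≥ 1}
-- for X and {m ≥ 1}; the higher levels are handled by induction.
levelRankSum-add : ∀ {n} (M : Matroid n) K (m : Fin n → ℕ) X → (∀ e → m e ≤ K) →
  levelRankSum M (λ e → 𝟙 (lookup X e) + m e) (suc K) ≤ r M X + levelRankSum M m K
levelRankSum-add M zero m X m≤0 = +-monoˡ-≤ 0 (≤-reflexive (cong (r M) (begin
  superlevel (λ e → 𝟙 (lookup X e) + m e) 1  ≡⟨ superlevel-𝟙+-1 X m ⟩
  X ∪ superlevel m 1                         ≡⟨ cong (X ∪_) (lookup-injective nothing≥1) ⟩
  X ∪ ⊥                                      ≡⟨ ∪-identityʳ X ⟩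
  X                                          ∎)))
  where
  open ≡-Reasoning
  nothing≥1 : ∀ e → lookup (superlevel m 1) e ≡ lookup ⊥ e
  nothing≥1 e rewrite lookup∘tabulate (λ e → 1 ≤ᵇ m e) e | n≤0⇒n≡0 (m≤0 e) = sym (lookup-replicate e outside)
levelRankSum-add M (suc K) m X m≤1+K = begin
    r M (superlevel m′ 1) + ∑[ i < suc K ] r M (superlevel m′ (2 + toℕ i))
      ≡⟨ cong₂ _+_ (cong (r M) (superlevel-𝟙+-1 X m))
                   (sum-cong-≗ {suc K} (λ i → cong (r M) (superlevel-𝟙+-suc X m (toℕ i)))) ⟩
    r M (X ∪ m≥1) + levelRankSum M m″ (suc K)
      ≤⟨ +-monoʳ-≤ (r M (X ∪ m≥1)) (levelRankSum-add M K m-1 (X ∩ m≥1) (λ e → ∸-monoˡ-≤ 1 (m≤1+K e))) ⟩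
    r M (X ∪ m≥1) + (r M (X ∩ m≥1) + levelRankSum M m-1 K)
      ≡⟨ +-assoc (r M (X ∪ m≥1)) _ _ ⟨
    r M (X ∪ m≥1) + r M (X ∩ m≥1) + levelRankSum M m-1 K
      ≤⟨ +-monoˡ-≤ (levelRankSum M m-1 K) (r-submod M X m≥1) ⟩
    r M X + r M m≥1 + levelRankSum M m-1 K
      ≡⟨ +-assoc (r M X) _ _ ⟩
    r M X + (r M m≥1 + levelRankSum M m-1 K)
      ≡⟨ cong (λ s → r M X + (r M m≥1 + s)) (sum-cong-≗ {K} (λ i → cong (r M) (superlevel-∸1 m (toℕ i)))) ⟩
    r M X + levelRankSum M m (suc K) ∎
  where
  open ≤-Reasoning
  m′ m-1 m″ : Fin _ → ℕ
  m′ e = 𝟙 (lookup X e) + m e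
  m-1 e = m e ∸ 1
  m≥1 = superlevel m 1
  m″ e = 𝟙 (lookup (X ∩ m≥1) e) + m-1 e

rearrangement : ∀ {n} (M : Matroid n) K (T : ℕ → Subset n) →
                levelRankSum M (multiplicity T K) K ≤ ∑[ c < K ] r M (T (toℕ c))
rearrangement M zero    T = z≤n
rearrangement M (suc K) T = ≤-trans
  (levelRankSum-add M K (multiplicity (T ∘ suc) K) (T 0) (λ e → ∑-≤1⇒≤n _ (λ c → 𝟙≤1 _)))
  (+-monoʳ-≤ (r M (T 0)) (rearrangement M K (T ∘ suc)))

listSum-applyUpTo : ∀ (f : ℕ → ℕ) m → ListAction.sum (applyUpTo f m) ≡ ∑[ i < m ] f (toℕ i)
listSum-applyUpTo f zero    = refl
listSum-applyUpTo f (suc m) = cong (f 0 +_) (listSum-applyUpTo (f ∘ suc) m)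

listSum-tabulate : ∀ {n} (f : Fin n → ℕ) → ListAction.sum (List.tabulate f) ≡ sum f
listSum-tabulate {zero}  f = refl
listSum-tabulate {suc n} f = cong (f zero +_) (listSum-tabulate (f ∘ suc))

rankSum≡∑ : ∀ {n} (M : Matroid n) ℓ A → rankSum M ℓ A ≡ ∑[ i < maxℓ ℓ ] r M (atLeast ℓ A (suc (toℕ i)))
rankSum≡∑ M ℓ A = begin
  ListAction.sum (List.map f (List.map suc (upTo (maxℓ ℓ))))  ≡⟨ cong ListAction.sum (map-∘ (upTo (maxℓ ℓ))) ⟨
  ListAction.sum (List.map (f ∘ suc) (upTo (maxℓ ℓ)))         ≡⟨ cong ListAction.sum (map-applyUpTo (λ i → i) (f ∘ suc) (maxℓ ℓ)) ⟩
  ListAction.sum (applyUpTo (f ∘ suc) (maxℓ ℓ))               ≡⟨ listSum-applyUpTo (f ∘ suc) (maxℓ ℓ) ⟩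
  ∑[ i < maxℓ ℓ ] f (suc (toℕ i))                             ∎
  where
  open ≡-Reasoning
  f : ℕ → ℕ
  f i = r M (atLeast ℓ A i)

weightSum≡weight : ∀ {n} (W : Fin n → ℕ) A → weightSum W A ≡ weight W A
weightSum≡weight {n} W A = begin
  ListAction.sum (List.map W (filter (_∈? A) (allFin n)))   ≡⟨ listSum-filter (allFin n) ⟩
  ListAction.sum (List.map (weightOn W A) (allFin n))       ≡⟨ cong ListAction.sum (map-tabulate (λ i → i) (weightOn W A)) ⟩
  ListAction.sum (List.tabulate (weightOn W A))             ≡⟨ listSum-tabulate (weightOn W A) ⟩
  weight W A                                                ∎
  where
  open ≡-Reasoning
  listSum-filter : ∀ xs → ListAction.sum (List.map W (filter (_∈? A) xs))
                          ≡ ListAction.sum (List.map (weightOn W A) xs)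
  listSum-filter []       = refl
  listSum-filter (x ∷ xs) with x ∈? A
  ... | yes x∈A rewrite ∈⇒lookup x∈A = cong (W x +_) (listSum-filter xs)
  ... | no  x∉A rewrite ∉⇒lookup x∉A = listSum-filter xs

≤⇒≤ᵇ≡true : ∀ {m n} → m ≤ n → (m ≤ᵇ n) ≡ true
≤⇒≤ᵇ≡true = Equivalence.to Bool.T-≡ ∘ ≤⇒≤ᵇ

∈-atLeast⁺ : ∀ {n} {ℓ : Fin n → ℕ} {A i x} → i ≤ ℓ x → x ∈ A → x ∈ atLeast ℓ A i
∈-atLeast⁺ {ℓ = ℓ} {A} {i} {x} i≤ℓx x∈A = lookup⇒∈ (begin
  lookup (atLeast ℓ A i) x                       ≡⟨ lookup∘tabulate (λ e → if i ≤ᵇ ℓ e then lookup A e else outside) x ⟩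
  (if i ≤ᵇ ℓ x then lookup A x else outside)     ≡⟨ cong (if_then lookup A x else outside) (≤⇒≤ᵇ≡true i≤ℓx) ⟩
  lookup A x                                     ≡⟨ ∈⇒lookup x∈A ⟩
  inside                                         ∎)
  where open ≡-Reasoning

∈-atLeast⁻ : ∀ {n} {ℓ : Fin n → ℕ} {A i x} → x ∈ atLeast ℓ A i → i ≤ ℓ x × x ∈ A
∈-atLeast⁻ {ℓ = ℓ} {A} {i} {x} x∈
  with i ≤ᵇ ℓ x in i≤ᵇℓx
     | trans (sym (lookup∘tabulate (λ e → if i ≤ᵇ ℓ e then lookup A e else outside) x)) (∈⇒lookup x∈)
... | true | A[x] = ≤ᵇ⇒≤ i (ℓ x) (Equivalence.from Bool.T-≡ i≤ᵇℓx) , lookup⇒∈ A[x]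

∈-superlevel⁺ : ∀ {n} {m : Fin n → ℕ} {i x} → i ≤ m x → x ∈ superlevel m i
∈-superlevel⁺ {m = m} {i} {x} i≤mx =
  lookup⇒∈ (trans (lookup∘tabulate (λ e → i ≤ᵇ m e) x) (≤⇒≤ᵇ≡true i≤mx))

∈⇒≤listSum : ∀ {y} {xs : List ℕ} → y ∈ˡ xs → y ≤ ListAction.sum xs
∈⇒≤listSum (Any.here refl) = m≤m+n _ _
∈⇒≤listSum {xs = x ∷ xs} (Any.there y∈xs) = m≤n⇒m≤o+n x (∈⇒≤listSum y∈xs)

≤maxℓ : ∀ {n} (ℓ : Fin n → ℕ) e → ℓ e ≤ maxℓ ℓ
≤maxℓ {n} ℓ e = ≤-foldr (∈-map⁺ ℓ (∈-allFin e))
  where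
  ≤-foldr : ∀ {y} {xs : List ℕ} → y ∈ˡ xs → y ≤ List.foldr _⊔_ 0 xs
  ≤-foldr (Any.here refl)            = m≤m⊔n _ _
  ≤-foldr {xs = x ∷ xs} (Any.there y∈) = ≤-trans (≤-foldr y∈) (m≤n⊔m x _)

∈-stdLists⁻ : ∀ {n} (ℓ : Fin n → ℕ) {e y} → y ∈ˡ stdLists ℓ e → ∃ λ j → j < ℓ e × y ≡ suc j
∈-stdLists⁻ ℓ y∈ with j , j∈ , y≡1+j ← ∈-map⁻ suc y∈ = j , ∈-upTo⁻ j∈ , y≡1+j

stdLists-hasSize : ∀ {n} (ℓ : Fin n → ℕ) → HasSize (stdLists ℓ) ℓ
stdLists-hasSize ℓ e = map⁺ suc-injective (upTo⁺ (ℓ e)) , trans (length-map suc (upTo (ℓ e))) (length-upTo (ℓ e))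

𝟙a+𝟙b≤𝟙[a∨b] : ∀ a b → (a ≡ true → b ≡ false) → 𝟙 a + 𝟙 b ≤ 𝟙 (a ∨ b)
𝟙a+𝟙b≤𝟙[a∨b] true  b exclusive rewrite exclusive refl = ≤-refl
𝟙a+𝟙b≤𝟙[a∨b] false b _                                = ≤-refl

does≡true⇒ : ∀ {P : Set} (P? : Dec P) → does P? ≡ true → P
does≡true⇒ (yes p) _ = p

length≤count : ∀ (f : ℕ → ℕ) m {xs : List ℕ} → Unique xs →
               (∀ {y} → y ∈ˡ xs → ∃ λ i → i < m × y ≡ f i) →
               length xs ≤ ∑[ i < m ] 𝟙 (does (f (toℕ i) ∈ˡ? xs))
length≤count f m {[]}     _                   _     = z≤n
length≤count f m {x ∷ xs} (x∉xs AllPairs.∷ xs-unique) image = begin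
  1 + length xs
    ≤⟨ +-mono-≤ x-counted (length≤count f m xs-unique (image ∘ Any.there)) ⟩
  ∑[ i < m ] 𝟙 (does (f (toℕ i) ≟ x)) + ∑[ i < m ] 𝟙 (does (f (toℕ i) ∈ˡ? xs))
    ≡⟨ ∑-distrib-+ {m} (λ i → 𝟙 (does (f (toℕ i) ≟ x))) _ ⟨
  ∑[ i < m ] (𝟙 (does (f (toℕ i) ≟ x)) + 𝟙 (does (f (toℕ i) ∈ˡ? xs)))
    ≤⟨ ∑-mono-≤ {m} pointwise ⟩
  ∑[ i < m ] 𝟙 (does (f (toℕ i) ∈ˡ? (x ∷ xs)))
    ∎
  where
  open ≤-Reasoning
  x-counted : 1 ≤ ∑[ i < m ] 𝟙 (does (f (toℕ i) ≟ x))
  x-counted with i , i<m , x≡fi ← image (Any.here refl) = begin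
    1                                                    ≡⟨ cong 𝟙 (dec-true (f (toℕ (fromℕ< i<m)) ≟ x) fi≡x) ⟨
    𝟙 (does (f (toℕ (fromℕ< i<m)) ≟ x))                  ≤⟨ ≤-∑ (λ j → 𝟙 (does (f (toℕ j) ≟ x))) (fromℕ< i<m) ⟩
    ∑[ j < m ] 𝟙 (does (f (toℕ j) ≟ x))                  ∎
    where
    fi≡x : f (toℕ (fromℕ< i<m)) ≡ x
    fi≡x = trans (cong f (Fin.toℕ-fromℕ< i<m)) (sym x≡fi)
  pointwise : ∀ i → 𝟙 (does (f (toℕ i) ≟ x)) + 𝟙 (does (f (toℕ i) ∈ˡ? xs))
                    ≤ 𝟙 (does (f (toℕ i) ∈ˡ? (x ∷ xs)))
  pointwise i = 𝟙a+𝟙b≤𝟙[a∨b] _ _ λ fi≟x → dec-false (f (toℕ i) ∈ˡ? xs)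
    (All¬⇒¬Any x∉xs ∘ subst (_∈ˡ xs) (does≡true⇒ (f (toℕ i) ≟ x) fi≟x))

module ListAssignment {n} (M : Matroid n) (ℓ : Fin n → ℕ) (L : Fin n → List ℕ) (L-size : HasSize L ℓ) where

  S : ℕ → Subset n
  S c = colourClass L c

  -- K exceeds max ℓ and every colour occurring in L.
  K : ℕ
  K = maxℓ ℓ + suc (∑[ e < n ] ListAction.sum (L e))

  colour<K : ∀ {x c} → c ∈ˡ L x → c < K
  colour<K {x} c∈Lx = m≤n⇒m≤o+n (maxℓ ℓ)
    (s≤s (≤-trans (∈⇒≤listSum c∈Lx) (≤-∑ (λ e → ListAction.sum (L e)) x)))

  Ms : ℕ → Matroid n
  Ms c = restrict M (S c)

  rankSum≤totalRank : ∀ A → rankSum M ℓ A ≤ totalRank Ms K A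
  rankSum≤totalRank A = begin
    rankSum M ℓ A                                     ≡⟨ rankSum≡∑ M ℓ A ⟩
    ∑[ i < maxℓ ℓ ] r M (atLeast ℓ A (suc (toℕ i)))   ≤⟨ ∑-prefix-≤ (maxℓ ℓ) _ (λ i → r M (atLeast ℓ A (suc i))) ⟩
    ∑[ i < K ] r M (atLeast ℓ A (suc (toℕ i)))        ≤⟨ ∑-mono-≤ {K} (λ i → r-mono M _ _ (atLeast⊆superlevel (suc (toℕ i)))) ⟩
    levelRankSum M (multiplicity T K) K               ≤⟨ rearrangement M K T ⟩
    totalRank Ms K A                                  ∎
    where
    open ≤-Reasoning
    T : ℕ → Subset n
    T c = A ∩ S c

    ℓ≤multiplicity : ∀ {x} → x ∈ A → ℓ x ≤ multiplicity T K x
    ℓ≤multiplicity {x} x∈A = begin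
      ℓ x                                    ≡⟨ proj₂ (L-size x) ⟨
      length (L x)                           ≤⟨ length≤count (λ c → c) K (proj₁ (L-size x)) (λ c∈ → _ , colour<K c∈ , refl) ⟩
      ∑[ c < K ] 𝟙 (does (toℕ c ∈ˡ? L x))    ≡⟨ sum-cong-≗ {K} (λ c → cong 𝟙 (T[x] (toℕ c))) ⟨
      multiplicity T K x                     ∎
      where
      T[x] : ∀ c → lookup (T c) x ≡ does (c ∈ˡ? L x)
      T[x] c = trans (lookup-∩ A (S c) x) (trans (cong (_∧ lookup (S c) x) (∈⇒lookup x∈A)) (lookup-colourClass L c x))

    atLeast⊆superlevel : ∀ j → atLeast ℓ A j ⊆ superlevel (multiplicity T K) j
    atLeast⊆superlevel j x∈ with j≤ℓx , x∈A ← ∈-atLeast⁻ {ℓ = ℓ} {A} {j} x∈ =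
      ∈-superlevel⁺ {m = multiplicity T K} (≤-trans j≤ℓx (ℓ≤multiplicity x∈A))

  covering⇒colourable : ∀ {W} → Covering Ms W → Colorable M W L
  covering⇒colourable (L′ , sizes , independent) =
    L′ , (λ e → proj₁ (sizes e) , proj₂ (sizes e) , L′⊆L) , independent′
    where
    L′⊆L : ∀ {e c} → c ∈ˡ L′ e → c ∈ˡ L e
    L′⊆L c∈L′e = ∈-colourClass⁻ {L = L}
      (proj₁ (independent-restrict M (S _) (independent _)) (∈-colourClass⁺ {L = L′} c∈L′e))

    independent′ : ∀ c → Independent M (colourClass L′ c)
    independent′ c = proj₂ (independent-restrict M (S c) (independent c))

module _ {n} (M : Matroid n) (ℓ W : Fin n → ℕ) where

  stdColourable⇒rankCondition : Colorable M W (stdLists ℓ) → ∀ A → rankSum M ℓ A ≥ weightSum W A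
  stdColourable⇒rankCondition (L′ , L′-valid , independent) A = begin
    weightSum W A                                        ≡⟨ weightSum≡weight W A ⟩
    weight W A                                           ≤⟨ ∑-mono-≤ W≤colours ⟩
    ∑[ e < n ] ∑[ i < m ] 𝟙 (lookup (C i ∩ A) e)         ≡⟨ ∑-comm (λ e i → 𝟙 (lookup (C i ∩ A) e)) ⟩
    ∑[ i < m ] ∑[ e < n ] 𝟙 (lookup (C i ∩ A) e)         ≡⟨ sum-cong-≗ {m} (λ i → ∣p∣≡∑𝟙 (C i ∩ A)) ⟨
    ∑[ i < m ] ∣ C i ∩ A ∣                               ≡⟨ sum-cong-≗ {m} (λ i → independent-∩ M (independent _) A) ⟨
    ∑[ i < m ] r M (C i ∩ A)                             ≤⟨ ∑-mono-≤ {m} (λ i → r-mono M _ _ (C∩A⊆atLeast i)) ⟩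
    ∑[ i < m ] r M (atLeast ℓ A (suc (toℕ i)))           ≡⟨ rankSum≡∑ M ℓ A ⟨
    rankSum M ℓ A                                        ∎
    where
    open ≤-Reasoning
    m : ℕ
    m = maxℓ ℓ
    C : Fin m → Subset n
    C i = colourClass L′ (suc (toℕ i))

    colour-bound : ∀ {e y} → y ∈ˡ L′ e → ∃ λ j → j < ℓ e × y ≡ suc j
    colour-bound {e} = ∈-stdLists⁻ ℓ ∘ proj₂ (proj₂ (L′-valid e))

    W≤colours : ∀ e → weightOn W A e ≤ ∑[ i < m ] 𝟙 (lookup (C i ∩ A) e)
    W≤colours e with lookup A e in A[e]
    ... | false = z≤n
    ... | true  = begin
      W e                                        ≡⟨ proj₁ (proj₂ (L′-valid e)) ⟨
      length (L′ e)                              ≤⟨ length≤count suc m (proj₁ (L′-valid e)) colour<m ⟩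
      ∑[ i < m ] 𝟙 (does (suc (toℕ i) ∈ˡ? L′ e)) ≡⟨ sum-cong-≗ {m} (λ i → cong 𝟙 (C∩A[e] i)) ⟨
      ∑[ i < m ] 𝟙 (lookup (C i ∩ A) e)          ∎
      where
      colour<m : ∀ {y} → y ∈ˡ L′ e → ∃ λ j → j < m × y ≡ suc j
      colour<m y∈ with j , j<ℓe , y≡1+j ← colour-bound y∈ = j , ≤-trans j<ℓe (≤maxℓ ℓ e) , y≡1+j
      C∩A[e] : ∀ i → lookup (C i ∩ A) e ≡ does (suc (toℕ i) ∈ˡ? L′ e)
      C∩A[e] i = trans (lookup-∩ (C i) A e) (trans (cong (lookup (C i) e ∧_) A[e])
                   (trans (Bool.∧-identityʳ _) (lookup-colourClass L′ (suc (toℕ i)) e)))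

    C∩A⊆atLeast : ∀ i → C i ∩ A ⊆ atLeast ℓ A (suc (toℕ i))
    C∩A⊆atLeast i x∈C∩A with x∈C , x∈A ← x∈p∩q⁻ (C i) A x∈C∩A
      with j , j<ℓx , refl ← colour-bound (∈-colourClass⁻ {L = L′} x∈C) = ∈-atLeast⁺ {ℓ = ℓ} j<ℓx x∈A

  rankCondition⇒colourable : (∀ A → rankSum M ℓ A ≥ weightSum W A) →
                             ∀ L → HasSize L ℓ → Colorable M W L
  rankCondition⇒colourable rank-condition L L-size =
    covering⇒colourable (covering-theorem Ms K W λ A → begin
      weight W A          ≡⟨ weightSum≡weight W A ⟨
      weightSum W A       ≤⟨ rank-condition A ⟩
      rankSum M ℓ A       ≤⟨ rankSum≤totalRank A ⟩
      totalRank Ms K A    ∎)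
    where
    open ListAssignment M ℓ L L-size
    open ≤-Reasoning

theorem4 : {n : ℕ} (M : Matroid n) (ℓ W : Fin n → ℕ) →
    (((L : Fin n → List ℕ) → HasSize L ℓ → Colorable M W L) ⇔ Colorable M W (stdLists ℓ))
    × (Colorable M W (stdLists ℓ) ⇔ ((A : Subset n) → rankSum M ℓ A ≥ weightSum W A))
theorem4 M ℓ W =
  mk⇔ (λ all-lists → all-lists (stdLists ℓ) (stdLists-hasSize ℓ))
      (rankCondition⇒colourable M ℓ W ∘ stdColourable⇒rankCondition M ℓ W) ,
  mk⇔ (stdColourable⇒rankCondition M ℓ W)
      (λ rank-condition → rankCondition⇒colourable M ℓ W rank-condition (stdLists ℓ) (stdLists-hasSize ℓ))
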